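{- Let $\mathcal{H}$ be a set of bipartite graphs on the vertex set of $K_{n,m}$, let $\mathcal{C}(\mathcal{H})$ be the set of $\mathcal{H}$-covered graphs, and let $\mathcal{P}=(\mathcal{C}(\mathcal{H})\cup\{\hat0\},\subseteq)$, where $\hat0$ is the empty graph and the order is inclusion of edge sets, with M\"obius function $\mu_{\mathcal{P}}$. Then \[f_{\mathcal{H}}(x_{1,1},\dots,x_{n,m})=\sum_{G\in\mathcal{C}(\mathcal{H})}-\mu_{\mathcal{P}}(\hat0,G)\prod_{(i,j)\in E(G)}x_{i,j},\] i.e. the coefficients of the multilinear real polynomial of $f_{\mathcal{H}}$ are the negated M\"obius numbers of $\mathcal{P}$.
   Context: Graphs on the vertex set of $K_{n,m}$ are identified with edge sets; input $x\in\{0,1\}^{nm}$ corresponds to the graph with edges $\{(i,j):x_{i,j}=1\}$. The graph cover function is $f_{\mathcal{H}}(G)=1$ iff some $H\in\mathcal{H}$ satisfies $E(H)\subseteq E(G)$. $G$ is $\mathcal{H}$-covered if there is a nonempty $S\subseteq\mathcal{H}$ with $\bigcup_{H\in S}E(H)=E(G)$. The M\"obius function of a finite poset $(P,<)$ is defined by $\mu(x,x)=1$ and $\mu(y,x)=-\sum_{y\le z<x}\mu(y,z)$ for $y<x$. -}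

module Defs where

open import Data.Bool using (Bool; true; false; _∨_; if_then_else_; T)
open import Level using (0ℓ)
import Data.Bool.Properties as BoolP
open import Data.Nat using (ℕ; zero; suc)
open import Data.Integer using (ℤ; _+_; _*_; -_; 0ℤ; 1ℤ)
open import Data.Fin using (Fin)
open import Data.Fin.Properties using (all?)
open import Data.Vec using (Vec; lookup; replicate; zipWith)
open import Data.Vec.Properties using (≡-dec)
open import Data.List using (List; []; _∷_; _++_; map; foldr; filter; deduplicate; allFin; length)
open import Data.List.Relation.Unary.Any using (Any; any?)
open import Data.Maybe using (Maybe; just; nothing)
open import Relation.Nullary using (Dec; yes; no; does; ¬_; ¬?)
open import Relation.Nullary.Decidable using (_→-dec_; _×-dec_)
open import Relation.Binary.PropositionalEquality using (_≡_; refl)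
open import Relation.Binary.Definitions using (DecidableEquality)
open import Data.Product using (_×_)
open import Relation.Unary using (Pred)
import Relation.Binary as B

-- Graphs on the vertex set of K_{n,m}, identified with their edge sets:
-- G i j = true  iff  (i , j) ∈ E(G).  An input x ∈ {0,1}^{nm} is the
-- same thing (x_{i,j} = 1 iff edge (i,j) present).

Graph : ℕ → ℕ → Set
Graph n m = Vec (Vec Bool m) n

edge : ∀ {n m} → Graph n m → Fin n → Fin m → Bool
edge G i j = lookup (lookup G i) j

_⊆ᴱ_ : ∀ {n m} → Graph n m → Graph n m → Set
H ⊆ᴱ G = ∀ i j → edge H i j ≡ true → edge G i j ≡ true

_⊆ᴱ?_ : ∀ {n m} (H G : Graph n m) → Dec (H ⊆ᴱ G)
H ⊆ᴱ? G = all? (λ i → all? (λ j → (edge H i j BoolP.≟ true) →-dec (edge G i j BoolP.≟ true)))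

_≟ᴳ_ : ∀ {n m} → DecidableEquality (Graph n m)
_≟ᴳ_ = ≡-dec (≡-dec BoolP._≟_)

emptyGraph : ∀ {n m} → Graph n m
emptyGraph = replicate _ (replicate _ false)

_∪ᴳ_ : ∀ {n m} → Graph n m → Graph n m → Graph n m
G ∪ᴳ K = zipWith (zipWith _∨_) G K

⋃ᴳ : ∀ {n m} → List (Graph n m) → Graph n m
⋃ᴳ = foldr _∪ᴳ_ emptyGraph

subLists : ∀ {a} {A : Set a} → List A → List (List A)
subLists [] = [] ∷ []
subLists (x ∷ xs) = subLists xs ++ map (x ∷_) (subLists xs)

nonemptySubLists : ∀ {a} {A : Set a} → List A → List (List A)
nonemptySubLists xs = filter nonEmpty? (subLists xs)
  where
  NonEmpty : ∀ {a} {A : Set a} → List A → Set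
  NonEmpty [] = T false
  NonEmpty (_ ∷ _) = T true
  nonEmpty? : ∀ {a} {A : Set a} → (l : List A) → Dec (NonEmpty l)
  nonEmpty? [] = no λ ()
  nonEmpty? (_ ∷ _) = yes _

coveredGraphs : ∀ {n m} → List (Graph n m) → List (Graph n m)
coveredGraphs ℋ = deduplicate _≟ᴳ_ (map ⋃ᴳ (nonemptySubLists ℋ))

fCover : ∀ {n m} → List (Graph n m) → Graph n m → ℤ
fCover ℋ x = if does (any? (λ H → H ⊆ᴱ? x) ℋ) then 1ℤ else 0ℤ

-- The recursion uses fuel; fuel suc (length elems) is always enough, since
-- a strict chain in the poset has at most (length elems) elements.

sumℤ : List ℤ → ℤ
sumℤ = foldr _+_ 0ℤ

module Möbius {A : Set} (_≟_ : DecidableEquality A)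
              {_≤_ : B.Rel A 0ℓ} (_≤?_ : B.Decidable _≤_)
              (elems : List A) where

  μ-fuel : ℕ → A → A → ℤ
  μ-fuel zero y x = 0ℤ
  μ-fuel (suc k) y x with does (y ≟ x) | does (y ≤? x)
  ... | true  | _     = 1ℤ
  ... | false | false = 0ℤ
  ... | false | true  =
        - sumℤ (map (μ-fuel k y)
                    (filter (λ z → (y ≤? z) ×-dec ((z ≤? x) ×-dec ¬? (z ≟ x))) elems))

  μ : A → A → ℤ
  μ = μ-fuel (suc (length elems))

-- The poset 𝒫 = (𝒞(ℋ) ∪ {0̂}, ⊆).  0̂ is represented by `nothing` and is
-- the bottom element; covered graphs are `just G`, ordered by edge inclusion.

data _≤𝒫_ {n m : ℕ} : Maybe (Graph n m) → Maybe (Graph n m) → Set where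
  0̂≤ : ∀ {p} → nothing ≤𝒫 p
  G≤K : ∀ {G K} → G ⊆ᴱ K → just G ≤𝒫 just K

_≤𝒫?_ : ∀ {n m} → B.Decidable (_≤𝒫_ {n} {m})
nothing ≤𝒫? q = yes 0̂≤
just G ≤𝒫? nothing = no λ ()
just G ≤𝒫? just K with G ⊆ᴱ? K
... | yes p = yes (G≤K p)
... | no ¬p = no λ { (G≤K p) → ¬p p }

_≟𝒫_ : ∀ {n m} → DecidableEquality (Maybe (Graph n m))
_≟𝒫_ = Data.Maybe.Properties.≡-dec _≟ᴳ_ where import Data.Maybe.Properties

0̂ : ∀ {n m} → Maybe (Graph n m)
0̂ = nothing

𝒫elems : ∀ {n m} → List (Graph n m) → List (Maybe (Graph n m))
𝒫elems ℋ = nothing ∷ map just (coveredGraphs ℋ)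

μ𝒫 : ∀ {n m} → List (Graph n m) → Maybe (Graph n m) → Maybe (Graph n m) → ℤ
μ𝒫 ℋ = Möbius.μ _≟𝒫_ _≤𝒫?_ (𝒫elems ℋ)

productℤ : List ℤ → ℤ
productℤ = foldr _*_ 1ℤ

bit : Bool → ℤ
bit b = if b then 1ℤ else 0ℤ

monomial : ∀ {n m} → Graph n m → Graph n m → ℤ
monomial {n} {m} G x =
  productℤ (map (λ i → productℤ (map (λ j →
     if edge G i j then bit (edge x i j) else 1ℤ) (allFin m))) (allFin n))

möbiusPoly : ∀ {n m} → List (Graph n m) → Graph n m → ℤ
möbiusPoly ℋ x =
  sumℤ (map (λ G → (- μ𝒫 ℋ 0̂ (just G)) * monomial G x) (coveredGraphs ℋ))

-- Since the monomial of G evaluates to [G ⊆ x], the right-hand side at x is the sum of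
-- -μ(0̂,G) over the covered graphs G ⊆ x.  If some H ∈ ℋ lies in x, the covered graphs
-- inside x are exactly those inside U = ⋃{H ∈ ℋ ∣ H ⊆ x}, itself covered, and the
-- defining recursion μ(0̂,U) = -(1 + Σ_{G ⊊ U} μ(0̂,G)) makes that sum equal to 1;
-- otherwise no covered graph lies in x and the sum is empty.
module Submission where

open import Defs
open import Data.Nat using (ℕ)
open import Data.List using (List)
open import Relation.Binary.PropositionalEquality using (_≡_)

open import Level using (Level; 0ℓ)
open import Function using (_∘_; _⇔_; mk⇔; Equivalence)
open import Data.Nat using (suc; _≤_; _<_; s≤s⁻¹)
open import Data.Nat.Properties using (<-≤-trans)
open import Data.Bool using (true; false; _∨_; if_then_else_)
open import Data.Bool.Properties using (⇔→≡; ∨-zeroʳ) renaming (_≟_ to _≟ᵇ_)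
open import Data.Integer using (ℤ; _+_; _*_; -_; 0ℤ; 1ℤ)
import Data.Integer.Properties as ℤ
open import Algebra.Properties.CommutativeSemigroup ℤ.+-commutativeSemigroup using (x∙yz≈y∙xz)
open import Data.Fin using (Fin)
open import Data.Fin.Properties using (all?; ¬∀⟶∃¬)
open import Data.Vec using (Vec; lookup)
open import Data.Vec.Properties using (lookup-zipWith; lookup-replicate; tabulate∘lookup; tabulate-cong)
open import Data.List using ([]; _∷_; map; filter; allFin; length)
open import Data.List.Properties
  using (map-∘; map-cong; map-cong-local; length-filter; filter-notAll; filter-accept; filter-reject; filter-none; filter-≐)
open import Data.List.Membership.Propositional using (_∈_; find)
open import Data.List.Membership.Propositional.Properties
  using (∈-map⁺; ∈-map⁻; ∈-filter⁺; ∈-filter⁻; ∈-deduplicate⁺; ∈-deduplicate⁻; ∈-allFin; ∈-++⁺ˡ; ∈-++⁺ʳ; ∈-++⁻)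
open import Data.List.Relation.Unary.Any using (Any; here; there; any?)
import Data.List.Relation.Unary.Any as Any
open import Data.List.Relation.Unary.All using (All; []; _∷_)
import Data.List.Relation.Unary.All as All
open import Data.List.Relation.Unary.AllPairs using (_∷_)
open import Data.List.Relation.Unary.Unique.Propositional using (Unique)
open import Data.List.Relation.Unary.Unique.DecPropositional.Properties using (deduplicate-!)
open import Data.Maybe using (Maybe; just; nothing)
open import Data.Product using (∃-syntax; _×_; _,_; proj₂)
open import Data.Sum using (inj₁; inj₂)
open import Relation.Nullary using (Dec; yes; no; does; ¬_; ¬?; contradiction)
open import Relation.Nullary.Decidable using (_×-dec_; _→-dec_)
open import Relation.Unary using (Pred; Decidable; _⊆_)
open import Relation.Unary.Properties using (_∩?_; ∁?)
open import Relation.Binary using (Rel; IsPartialOrder; DecidableEquality)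
import Relation.Binary as B
open import Relation.Binary.PropositionalEquality
  using (refl; sym; trans; cong; cong₂; subst; _≢_; isEquivalence; module ≡-Reasoning)

private
  variable
    p q : Level
    A : Set
    P : Pred A p
    Q : Pred A q

sum-map-neg : (f : A → ℤ) (l : List A) → sumℤ (map (-_ ∘ f) l) ≡ - sumℤ (map f l)
sum-map-neg f [] = refl
sum-map-neg f (x ∷ l) =
  trans (cong (- f x +_) (sum-map-neg f l)) (sym (ℤ.neg-distrib-+ (f x) (sumℤ (map f l))))

sum-map-*-bit : (f : A → ℤ) (P? : Decidable P) (l : List A) →
  sumℤ (map (λ z → f z * bit (does (P? z))) l) ≡ sumℤ (map f (filter P? l))
sum-map-*-bit f P? [] = refl
sum-map-*-bit f P? (x ∷ l) with ih ← sum-map-*-bit f P? l | does (P? x)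
... | true  = cong₂ _+_ (ℤ.*-identityʳ (f x)) ih
... | false = trans (cong₂ _+_ (ℤ.*-zeroʳ (f x)) ih) (ℤ.+-identityˡ _)

sum-filter-split : (f : A → ℤ) (P? : Decidable P) (Q? : Decidable Q) (l : List A) →
  sumℤ (map f (filter P? l)) ≡
  sumℤ (map f (filter (P? ∩? ∁? Q?) l)) + sumℤ (map f (filter (P? ∩? Q?) l))
sum-filter-split f P? Q? [] = refl
sum-filter-split f P? Q? (x ∷ l) with ih ← sum-filter-split f P? Q? l | does (P? x) | does (Q? x)
... | false | _     = ih
... | true  | false = trans (cong (f x +_) ih) (sym (ℤ.+-assoc (f x) _ _))
... | true  | true  = trans (cong (f x +_) ih) (x∙yz≈y∙xz (f x) (Σ (P? ∩? ∁? Q?)) (Σ (P? ∩? Q?)))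
  where
  Σ : ∀ {r} {R : Pred _ r} → Decidable R → ℤ
  Σ R? = sumℤ (map f (filter R? l))

filter-map : {B : Set} (f : B → A) (P? : Decidable P) (l : List B) →
  filter P? (map f l) ≡ map f (filter (P? ∘ f) l)
filter-map f P? [] = refl
filter-map f P? (x ∷ l) with does (P? (f x))
... | true  = cong (f x ∷_) (filter-map f P? l)
... | false = filter-map f P? l

filter-filter-⊆ : (P? : Decidable P) (Q? : Decidable Q) → P ⊆ Q →
  (l : List A) → filter P? (filter Q? l) ≡ filter P? l
filter-filter-⊆ P? Q? P⊆Q [] = refl
filter-filter-⊆ P? Q? P⊆Q (x ∷ l) with ih ← filter-filter-⊆ P? Q? P⊆Q l | Q? x
... | no ¬q = trans ih (sym (filter-reject P? (¬q ∘ P⊆Q)))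
... | yes _ with does (P? x)
...   | true  = cong (x ∷_) ih
...   | false = ih

filter-cong-local : (P? : Decidable P) (Q? : Decidable Q) {l : List A} →
  All (λ z → P z ⇔ Q z) l → filter P? l ≡ filter Q? l
filter-cong-local P? Q? [] = refl
filter-cong-local P? Q? {x ∷ l} (P⇔Q ∷ eqs) with ih ← filter-cong-local P? Q? eqs | P? x | Q? x
... | yes _ | yes _ = cong (x ∷_) ih
... | yes p | no ¬q = contradiction (Equivalence.to P⇔Q p) ¬q
... | no ¬p | yes q = contradiction (Equivalence.from P⇔Q q) ¬p
... | no _  | no _  = ih

∈-subLists⁻ : {S : List A} (l : List A) → S ∈ subLists l → ∀ {x} → x ∈ S → x ∈ l
∈-subLists⁻ [] (here refl) ()
∈-subLists⁻ (y ∷ l) S∈ x∈S with ∈-++⁻ (subLists l) S∈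
... | inj₁ S∈′ = there (∈-subLists⁻ l S∈′ x∈S)
... | inj₂ S∈′ with ∈-map⁻ (y ∷_) S∈′ | x∈S
...   | _ , _ , refl | here refl = here refl
...   | _ , S′∈ , refl | there x∈S′ = there (∈-subLists⁻ l S′∈ x∈S′)

filter-∈-subLists : (P? : Decidable P) (l : List A) → filter P? l ∈ subLists l
filter-∈-subLists P? [] = here refl
filter-∈-subLists P? (x ∷ l) with does (P? x)
... | true  = ∈-++⁺ʳ (subLists l) (∈-map⁺ (x ∷_) (filter-∈-subLists P? l))
... | false = ∈-++⁺ˡ (filter-∈-subLists P? l)

filter-≡-unique : (_≟_ : DecidableEquality A) {l : List A} {u : A} →
  Unique l → u ∈ l → filter (_≟ u) l ≡ u ∷ []
filter-≡-unique _≟_ (x∉l ∷ _) (here refl) =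
  trans (filter-accept (_≟ _) refl) (cong (_ ∷_) (filter-none (_≟ _) (All.map (_∘ sym) x∉l)))
filter-≡-unique _≟_ (x∉l ∷ l!) (there u∈) =
  trans (filter-reject (_≟ _) (All.lookup x∉l u∈)) (filter-≡-unique _≟_ l! u∈)

productℤ-≡1 : (f : A → ℤ) → (∀ z → f z ≡ 1ℤ) → (l : List A) → productℤ (map f l) ≡ 1ℤ
productℤ-≡1 f f≡1 [] = refl
productℤ-≡1 f f≡1 (x ∷ l) = cong₂ _*_ (f≡1 x) (productℤ-≡1 f f≡1 l)

productℤ-≡0 : (f : A → ℤ) {l : List A} {z : A} → z ∈ l → f z ≡ 0ℤ → productℤ (map f l) ≡ 0ℤ
productℤ-≡0 f {x ∷ l} (here refl) fz≡0 =
  trans (cong (_* productℤ (map f l)) fz≡0) (ℤ.*-zeroˡ (productℤ (map f l)))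
productℤ-≡0 f {x ∷ l} (there z∈) fz≡0 = trans (cong (f x *_) (productℤ-≡0 f z∈ fz≡0)) (ℤ.*-zeroʳ (f x))

-- Möbius.μ recurses with fuel.  The number of elements below x strictly decreases along
-- the recursion, so the fuel length elems suffices and μ satisfies its defining recursion.
module MöbiusRecursion {A : Set} (_≟_ : DecidableEquality A) {_⊑_ : Rel A 0ℓ} (_⊑?_ : B.Decidable _⊑_)
                       (⊑-isPartialOrder : IsPartialOrder _≡_ _⊑_) (elems : List A) where

  open Möbius _≟_ _⊑?_ elems
  open IsPartialOrder ⊑-isPartialOrder using (antisym) renaming (refl to ⊑-refl; trans to ⊑-trans)

  rank : A → ℕ
  rank x = length (filter (_⊑? x) elems)

  rank-< : ∀ {z x} → x ∈ elems → z ⊑ x → z ≢ x → rank z < rank x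
  rank-< {z} {x} x∈ z⊑x z≢x =
    subst (λ below-z → length below-z < rank x)
      (filter-filter-⊆ (_⊑? z) (_⊑? x) (λ w⊑z → ⊑-trans w⊑z z⊑x) elems)
      (filter-notAll (_⊑? z) (filter (_⊑? x) elems) x⋢z)
    where
    x⋢z : Any (λ w → ¬ w ⊑ z) (filter (_⊑? x) elems)
    x⋢z = Any.map (λ { refl x⊑z → z≢x (antisym z⊑x x⊑z) }) (∈-filter⁺ (_⊑? x) x∈ ⊑-refl)

  interval? : (y x : A) → Decidable (λ z → y ⊑ z × z ⊑ x × z ≢ x)
  interval? y x z = (y ⊑? z) ×-dec ((z ⊑? x) ×-dec ¬? (z ≟ x))

  μ-fuel-stable : ∀ k {y x} → x ∈ elems → rank x < k → μ-fuel k y x ≡ μ-fuel (suc k) y x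
  μ-fuel-stable-interval : ∀ k {y x} → x ∈ elems → rank x ≤ k →
    map (μ-fuel k y) (filter (interval? y x) elems) ≡ map (μ-fuel (suc k) y) (filter (interval? y x) elems)

  μ-fuel-stable (suc k) {y} {x} x∈ rx<k with does (y ≟ x) | does (y ⊑? x)
  ... | true  | _     = refl
  ... | false | false = refl
  ... | false | true  = cong (-_ ∘ sumℤ) (μ-fuel-stable-interval k x∈ (s≤s⁻¹ rx<k))

  μ-fuel-stable-interval k {y} {x} x∈ rx≤k = map-cong-local (All.tabulate stable)
    where
    stable : ∀ {z} → z ∈ filter (interval? y x) elems → μ-fuel k y z ≡ μ-fuel (suc k) y z
    stable z∈ with ∈-filter⁻ (interval? y x) z∈
    ... | z∈elems , _ , z⊑x , z≢x = μ-fuel-stable k z∈elems (<-≤-trans (rank-< x∈ z⊑x z≢x) rx≤k)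

  μ-unfold : ∀ {y x} → y ≢ x → y ⊑ x → x ∈ elems →
    μ y x ≡ - sumℤ (map (μ y) (filter (interval? y x) elems))
  μ-unfold {y} {x} y≢x y⊑x x∈ with y ≟ x | y ⊑? x
  ... | yes y≡x | _      = contradiction y≡x y≢x
  ... | no _    | no y⋢x = contradiction y⊑x y⋢x
  ... | no _    | yes _  =
    cong (-_ ∘ sumℤ) (μ-fuel-stable-interval (length elems) x∈ (length-filter (_⊑? x) elems))

module _ {n m : ℕ} where

  edge-∪ᴳ : (G K : Graph n m) (i : Fin n) (j : Fin m) → edge (G ∪ᴳ K) i j ≡ edge G i j ∨ edge K i j
  edge-∪ᴳ G K i j =
    trans (cong (λ row → lookup row j) (lookup-zipWith _ i G K))
          (lookup-zipWith _∨_ j (lookup G i) (lookup K i))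

  edge-emptyGraph : (i : Fin n) (j : Fin m) → edge (emptyGraph {n} {m}) i j ≡ false
  edge-emptyGraph i j = trans (cong (λ row → lookup row j) (lookup-replicate i _)) (lookup-replicate j false)

  graph-ext : {G K : Graph n m} → (∀ i j → edge G i j ≡ edge K i j) → G ≡ K
  graph-ext G≗K = lookup-ext (λ i → lookup-ext (G≗K i))
    where
    lookup-ext : ∀ {A : Set} {k} {xs ys : Vec A k} → (∀ i → lookup xs i ≡ lookup ys i) → xs ≡ ys
    lookup-ext {xs = xs} {ys} eq =
      trans (sym (tabulate∘lookup xs)) (trans (tabulate-cong eq) (tabulate∘lookup ys))

  ⊆ᴱ-refl : {G : Graph n m} → G ⊆ᴱ G
  ⊆ᴱ-refl i j e = e

  ⊆ᴱ-trans : {G K M : Graph n m} → G ⊆ᴱ K → K ⊆ᴱ M → G ⊆ᴱ M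
  ⊆ᴱ-trans G⊆K K⊆M i j e = K⊆M i j (G⊆K i j e)

  ⊆ᴱ-antisym : {G K : Graph n m} → G ⊆ᴱ K → K ⊆ᴱ G → G ≡ K
  ⊆ᴱ-antisym G⊆K K⊆G = graph-ext λ i j → ⇔→≡ (mk⇔ (G⊆K i j) (K⊆G i j))

  ⋃ᴳ-upper : {S : List (Graph n m)} {H : Graph n m} → H ∈ S → H ⊆ᴱ ⋃ᴳ S
  ⋃ᴳ-upper {G ∷ S} (here refl) i j e rewrite edge-∪ᴳ G (⋃ᴳ S) i j | e = refl
  ⋃ᴳ-upper {G ∷ S} (there H∈) i j e rewrite edge-∪ᴳ G (⋃ᴳ S) i j | ⋃ᴳ-upper H∈ i j e =
    ∨-zeroʳ (edge G i j)

  ⋃ᴳ-least : (S : List (Graph n m)) {K : Graph n m} → (∀ {H} → H ∈ S → H ⊆ᴱ K) → ⋃ᴳ S ⊆ᴱ K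
  ⋃ᴳ-least [] _ i j e = contradiction (trans (sym (edge-emptyGraph i j)) e) λ ()
  ⋃ᴳ-least (G ∷ S) {K} S⊆K i j e rewrite edge-∪ᴳ G (⋃ᴳ S) i j with edge G i j in eG
  ... | true  = S⊆K (here refl) i j eG
  ... | false = ⋃ᴳ-least S {K} (S⊆K ∘ there) i j e

  edge-⊆? : (G x : Graph n m) (i : Fin n) (j : Fin m) → Dec (edge G i j ≡ true → edge x i j ≡ true)
  edge-⊆? G x i j = (edge G i j ≟ᵇ true) →-dec (edge x i j ≟ᵇ true)

  ⊈ᴱ⇒missingEdge : {G x : Graph n m} → ¬ G ⊆ᴱ x → ∃[ i ] ∃[ j ] edge G i j ≡ true × edge x i j ≡ false
  ⊈ᴱ⇒missingEdge {G} {x} G⊈x with ¬∀⟶∃¬ n _ (λ i → all? (edge-⊆? G x i)) G⊈x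
  ... | i , i⊈ with ¬∀⟶∃¬ m _ (edge-⊆? G x i) i⊈
  ...   | j , ij⊈ with edge G i j in eG | edge x i j in ex
  ...     | true  | false = i , j , eG , ex
  ...     | true  | true  = contradiction (λ _ → refl) ij⊈
  ...     | false | _     = contradiction (λ ()) ij⊈

  monomialFactor : (G x : Graph n m) → Fin n → Fin m → ℤ
  monomialFactor G x i j = if edge G i j then bit (edge x i j) else 1ℤ

  monomial-≡1 : (G x : Graph n m) → G ⊆ᴱ x → monomial G x ≡ 1ℤ
  monomial-≡1 G x G⊆x =
    productℤ-≡1 (λ i → productℤ (map (monomialFactor G x i) (allFin m)))
      (λ i → productℤ-≡1 (monomialFactor G x i) (factor-≡1 i) (allFin m)) (allFin n)
    where
    factor-≡1 : ∀ i j → monomialFactor G x i j ≡ 1ℤ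
    factor-≡1 i j with edge G i j in eG
    ... | false = refl
    ... | true rewrite G⊆x i j eG = refl

  monomial-≡0 : (G x : Graph n m) → ¬ G ⊆ᴱ x → monomial G x ≡ 0ℤ
  monomial-≡0 G x G⊈x with ⊈ᴱ⇒missingEdge {G} {x} G⊈x
  ... | i , j , eG , ex =
    productℤ-≡0 (λ i → productℤ (map (monomialFactor G x i) (allFin m))) (∈-allFin i)
      (productℤ-≡0 (monomialFactor G x i) (∈-allFin j) (cong₂ (λ g b → if g then bit b else 1ℤ) eG ex))

  monomial-≡-bit : (G x : Graph n m) → monomial G x ≡ bit (does (G ⊆ᴱ? x))
  monomial-≡-bit G x = by-cases (G ⊆ᴱ? x)
    where
    by-cases : (G⊆?x : Dec (G ⊆ᴱ x)) → monomial G x ≡ bit (does G⊆?x)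
    by-cases (yes G⊆x) = monomial-≡1 G x G⊆x
    by-cases (no G⊈x)  = monomial-≡0 G x G⊈x

  ≤𝒫-isPartialOrder : IsPartialOrder _≡_ (_≤𝒫_ {n} {m})
  ≤𝒫-isPartialOrder = record
    { isPreorder = record
      { isEquivalence = isEquivalence
      ; reflexive = λ { {nothing} refl → 0̂≤ ; {just G} refl → G≤K (⊆ᴱ-refl {G}) }
      ; trans = λ { 0̂≤ _ → 0̂≤
                  ; (G≤K {G} {K} G⊆K) (G≤K {_} {M} K⊆M) → G≤K (⊆ᴱ-trans {G} {K} {M} G⊆K K⊆M) }
      }
    ; antisym = λ { 0̂≤ 0̂≤ → refl
                  ; (G≤K {G} {K} G⊆K) (G≤K K⊆G) → cong just (⊆ᴱ-antisym {G} {K} G⊆K K⊆G) }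
    }

module CoveredGraphs {n m : ℕ} (ℋ : List (Graph n m)) where

  𝒞 : List (Graph n m)
  𝒞 = coveredGraphs ℋ

  ∈-coveredGraphs⁺ : {S : List (Graph n m)} {H : Graph n m} → S ∈ subLists ℋ → H ∈ S → ⋃ᴳ S ∈ 𝒞
  ∈-coveredGraphs⁺ {_ ∷ _} S∈ _ = ∈-deduplicate⁺ _≟ᴳ_ (∈-map⁺ ⋃ᴳ (∈-filter⁺ _ S∈ _))

  ∈-coveredGraphs⁻ : {G : Graph n m} → G ∈ 𝒞 → ∃[ S ] ∃[ H ] S ∈ subLists ℋ × H ∈ S × G ≡ ⋃ᴳ S
  ∈-coveredGraphs⁻ G∈ with ∈-map⁻ ⋃ᴳ (∈-deduplicate⁻ _≟ᴳ_ (map ⋃ᴳ (nonemptySubLists ℋ)) G∈)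
  ... | S , S∈ , G≡⋃S with S | ∈-filter⁻ _ {xs = subLists ℋ} S∈
  ...   | H ∷ S′ | S∈subLists , _ = H ∷ S′ , H , S∈subLists , here refl , G≡⋃S

  largestCovered : Graph n m → Graph n m
  largestCovered x = ⋃ᴳ (filter (_⊆ᴱ? x) ℋ)

  largestCovered-⊆ᴱ : (x : Graph n m) → largestCovered x ⊆ᴱ x
  largestCovered-⊆ᴱ x = ⋃ᴳ-least (filter (_⊆ᴱ? x) ℋ) {x} (proj₂ ∘ ∈-filter⁻ (_⊆ᴱ? x) {xs = ℋ})

  largestCovered-∈ : {x : Graph n m} → Any (_⊆ᴱ x) ℋ → largestCovered x ∈ 𝒞
  largestCovered-∈ {x} any⊆x with find any⊆x
  ... | H , H∈ℋ , H⊆x =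
    ∈-coveredGraphs⁺ (filter-∈-subLists (_⊆ᴱ? x) ℋ) (∈-filter⁺ (_⊆ᴱ? x) H∈ℋ H⊆x)

  covered-⊆ᴱ-largestCovered : {G x : Graph n m} → G ∈ 𝒞 → G ⊆ᴱ x → G ⊆ᴱ largestCovered x
  covered-⊆ᴱ-largestCovered {x = x} G∈ G⊆x with ∈-coveredGraphs⁻ G∈
  ... | S , _ , S∈ , _ , refl = ⋃ᴳ-least S {largestCovered x} λ {H} H∈S →
    ⋃ᴳ-upper {S = filter (_⊆ᴱ? x) ℋ}
      (∈-filter⁺ (_⊆ᴱ? x) (∈-subLists⁻ ℋ S∈ H∈S) (⊆ᴱ-trans {G = H} {⋃ᴳ S} {x} (⋃ᴳ-upper {S = S} H∈S) G⊆x))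

  covered-⊆ᴱ⇒any : {G x : Graph n m} → G ∈ 𝒞 → G ⊆ᴱ x → Any (_⊆ᴱ x) ℋ
  covered-⊆ᴱ⇒any {x = x} G∈ G⊆x with ∈-coveredGraphs⁻ G∈
  ... | S , H , S∈ , H∈S , refl =
    Any.map (λ { refl → ⊆ᴱ-trans {G = H} {⋃ᴳ S} {x} (⋃ᴳ-upper {S = S} H∈S) G⊆x })
      (∈-subLists⁻ ℋ S∈ H∈S)

  open MöbiusRecursion _≟𝒫_ _≤𝒫?_ ≤𝒫-isPartialOrder (𝒫elems ℋ) using (interval?; μ-unfold)

  ⊊? : (U : Graph n m) → Decidable (λ G → G ⊆ᴱ U × G ≢ U)
  ⊊? U = (_⊆ᴱ? U) ∩? ∁? (_≟ᴳ U)

  μ𝒫-covered : {U : Graph n m} → U ∈ 𝒞 →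
    μ𝒫 ℋ 0̂ (just U) ≡ - (1ℤ + sumℤ (map (μ𝒫 ℋ 0̂ ∘ just) (filter (⊊? U) 𝒞)))
  μ𝒫-covered {U} U∈ = begin
    μ𝒫 ℋ 0̂ (just U)
      ≡⟨ μ-unfold (λ ()) 0̂≤ (there (∈-map⁺ just U∈)) ⟩
    -- the summand of 0̂ ∈ [0̂, U) is μ(0̂,0̂) = 1
    - (1ℤ + sumℤ (map μ₀ (filter (interval? 0̂ (just U)) (map just 𝒞))))
      ≡⟨ cong (λ l → - (1ℤ + sumℤ (map μ₀ l))) (filter-map just (interval? 0̂ (just U)) 𝒞) ⟩
    - (1ℤ + sumℤ (map μ₀ (map just (filter (interval? 0̂ (just U) ∘ just) 𝒞))))
      ≡⟨ cong (λ l → - (1ℤ + sumℤ l)) (sym (map-∘ {g = μ₀} {f = just} (filter (interval? 0̂ (just U) ∘ just) 𝒞)))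
       ⟩
    - (1ℤ + sumℤ (map (μ₀ ∘ just) (filter (interval? 0̂ (just U) ∘ just) 𝒞)))
      ≡⟨ cong (λ l → - (1ℤ + sumℤ (map (μ₀ ∘ just) l))) (filter-≐ _ (⊊? U) (to , from) 𝒞) ⟩
    - (1ℤ + sumℤ (map (μ₀ ∘ just) (filter (⊊? U) 𝒞))) ∎
    where
    open ≡-Reasoning
    μ₀ : Maybe (Graph n m) → ℤ
    μ₀ = μ𝒫 ℋ 0̂
    to : ∀ {G} → 0̂ ≤𝒫 just G × just G ≤𝒫 just U × just G ≢ just U → G ⊆ᴱ U × G ≢ U
    to (_ , G≤K G⊆U , G≢U) = G⊆U , G≢U ∘ cong just
    from : ∀ {G} → G ⊆ᴱ U × G ≢ U → 0̂ ≤𝒫 just G × just G ≤𝒫 just U × just G ≢ just U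
    from (G⊆U , G≢U) = 0̂≤ , G≤K G⊆U , λ { refl → G≢U refl }

  ν : Graph n m → ℤ
  ν G = - μ𝒫 ℋ 0̂ (just G)

  sum-ν-⊆ᴱ-covered : {U : Graph n m} → U ∈ 𝒞 → sumℤ (map ν (filter (_⊆ᴱ? U) 𝒞)) ≡ 1ℤ
  sum-ν-⊆ᴱ-covered {U} U∈ = begin
    sumℤ (map ν (filter (_⊆ᴱ? U) 𝒞))
      ≡⟨ sum-filter-split ν (_⊆ᴱ? U) (_≟ᴳ U) 𝒞 ⟩
    sumℤ (map ν (filter (⊊? U) 𝒞)) + sumℤ (map ν (filter ((_⊆ᴱ? U) ∩? (_≟ᴳ U)) 𝒞))
      ≡⟨ cong₂ _+_ (sum-map-neg (μ𝒫 ℋ 0̂ ∘ just) (filter (⊊? U) 𝒞)) (cong (sumℤ ∘ map ν) only-U) ⟩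
    - S + (ν U + 0ℤ)
      ≡⟨ cong (λ μU → - S + (- μU + 0ℤ)) (μ𝒫-covered U∈) ⟩
    - S + (- - (1ℤ + S) + 0ℤ)
      ≡⟨ cong (- S +_) (trans (ℤ.+-identityʳ _) (ℤ.neg-involutive (1ℤ + S))) ⟩
    - S + (1ℤ + S)
      ≡⟨ x∙yz≈y∙xz (- S) 1ℤ S ⟩
    1ℤ + (- S + S)
      ≡⟨ cong (1ℤ +_) (ℤ.+-inverseˡ S) ⟩
    1ℤ ∎
    where
    open ≡-Reasoning
    S : ℤ
    S = sumℤ (map (μ𝒫 ℋ 0̂ ∘ just) (filter (⊊? U) 𝒞))
    only-U : filter ((_⊆ᴱ? U) ∩? (_≟ᴳ U)) 𝒞 ≡ U ∷ []
    only-U = trans (filter-≐ _ (_≟ᴳ U) (proj₂ , λ { refl → ⊆ᴱ-refl {G = U} , refl }) 𝒞)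
                   (filter-≡-unique _≟ᴳ_ (deduplicate-! _≟ᴳ_ _) U∈)

  sum-ν-⊆ᴱ : (x : Graph n m) → sumℤ (map ν (filter (_⊆ᴱ? x) 𝒞)) ≡ fCover ℋ x
  sum-ν-⊆ᴱ x = by-cases (any? (_⊆ᴱ? x) ℋ)
    where
    U : Graph n m
    U = largestCovered x
    ⊆x⇔⊆U : ∀ {G} → G ∈ 𝒞 → G ⊆ᴱ x ⇔ G ⊆ᴱ U
    ⊆x⇔⊆U {G} G∈ = mk⇔ (covered-⊆ᴱ-largestCovered {G} {x} G∈)
                       (λ G⊆U → ⊆ᴱ-trans {G = G} {U} {x} G⊆U (largestCovered-⊆ᴱ x))
    by-cases : (any⊆x : Dec (Any (_⊆ᴱ x) ℋ)) → sumℤ (map ν (filter (_⊆ᴱ? x) 𝒞)) ≡ bit (does any⊆x)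
    by-cases (no ¬any) = cong (sumℤ ∘ map ν)
      (filter-none (_⊆ᴱ? x) (All.tabulate λ {G} G∈ G⊆x → ¬any (covered-⊆ᴱ⇒any {G} {x} G∈ G⊆x)))
    by-cases (yes any) =
      trans (cong (sumℤ ∘ map ν) (filter-cong-local (_⊆ᴱ? x) (_⊆ᴱ? U) (All.tabulate ⊆x⇔⊆U)))
            (sum-ν-⊆ᴱ-covered (largestCovered-∈ {x} any))

proposition3p4 : (n m : ℕ) (ℋ : List (Graph n m)) (x : Graph n m) →
    fCover ℋ x ≡ möbiusPoly ℋ x
proposition3p4 n m ℋ x = sym (begin
  möbiusPoly ℋ x
    ≡⟨ cong sumℤ (map-cong (λ G → cong (ν G *_) (monomial-≡-bit G x)) 𝒞) ⟩
  sumℤ (map (λ G → ν G * bit (does (G ⊆ᴱ? x))) 𝒞)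
    ≡⟨ sum-map-*-bit ν (_⊆ᴱ? x) 𝒞 ⟩
  sumℤ (map ν (filter (_⊆ᴱ? x) 𝒞))
    ≡⟨ sum-ν-⊆ᴱ x ⟩
  fCover ℋ x ∎)
  where
  open ≡-Reasoning
  open CoveredGraphs ℋ
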